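{- Let $0\le a\le n$ with $2\mid(n-a)$, and let $\mathcal{M}_{n,a}$ be the set of permutation matrices of involutions in $\mathfrak{S}_n$ with exactly $a$ fixed points. For any $0\le d\le(n-a)/2$, the vector space $\mathbb{C}[\mathbf{x}_{n\times n}]_{\le d}/(\mathbf{I}(\mathcal{M}_{n,a})\cap\mathbb{C}[\mathbf{x}_{n\times n}]_{\le d})$ is spanned by the images of $\{\mathfrak{m}(w): w\in\mathfrak{S}_n \text{ an involution with exactly } d \text{ two-cycles}\}$.
   Context: $\mathbf{x}_{n\times n}=(x_{i,j})$ is a matrix of variables; $\mathbb{C}[\mathbf{x}_{n\times n}]_{\le d}$ is the space of polynomials of degree at most $d$; $\mathbf{I}(\mathcal{Z})$ is the ideal of polynomials vanishing on $\mathcal{Z}$. For an involution $w$, $\mathfrak{m}(w)=\prod_{i<j,\,w(i)=j}x_{i,j}$. -}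

module Defs where

open import Level using (_⊔_)
open import Data.Nat using (ℕ; zero; suc; _+_; _<_; _≤_)
open import Data.Fin using (Fin; toℕ)
open import Data.Fin.Properties using (_≟_)
open import Data.List using (List; []; _∷_; filter; length; map; foldr)
open import Data.List.Relation.Unary.All using (All)
open import Data.Product using (_×_; _,_; Σ; proj₁; proj₂)
open import Relation.Binary.PropositionalEquality using (_≡_)
open import Relation.Nullary using (¬_; Dec; yes; no)
open import Algebra.Bundles using (CommutativeRing)
import Data.Nat.Properties as ℕP
open import Data.Fin.Base using () renaming (_<_ to _<ᶠ_)
open import Data.Fin.Properties using () renaming (_<?_ to _<?ᶠ_)
open import Data.List using (allFin)

natCast : ∀ {c ℓ} (R : CommutativeRing c ℓ) → ℕ → CommutativeRing.Carrier R
natCast R zero    = CommutativeRing.0# R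
natCast R (suc k) = CommutativeRing._+_ R (CommutativeRing.1# R) (natCast R k)

-- A field of characteristic zero (stdlib has no Field bundle).
-- ℂ is an instance.
record CharZeroField (c ℓ : Level.Level) : Set (Level.suc (c ⊔ ℓ)) where
  field
    commutativeRing : CommutativeRing c ℓ
  open CommutativeRing commutativeRing public
  field
    inverse  : ∀ x → ¬ (x ≈ 0#) → Σ Carrier λ y → x * y ≈ 1#
    charZero : ∀ k → ¬ (natCast commutativeRing (suc k) ≈ 0#)

IsInvolution : ∀ {n} → (Fin n → Fin n) → Set
IsInvolution w = ∀ i → w (w i) ≡ i

fixedPoints : ∀ {n} → (Fin n → Fin n) → ℕ
fixedPoints {n} w = length (filter (λ i → w i ≟ i) (allFin n))

-- number of two-cycles  #{ i | i < w i }  (for an involution)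
twoCycles : ∀ {n} → (Fin n → Fin n) → ℕ
twoCycles {n} w = length (filter (λ i → i <?ᶠ w i) (allFin n))

-- exponent vector of a monomial ∏ x_{i,j}^{α i j}
Monomial : ℕ → Set
Monomial n = Fin n → Fin n → ℕ

sumFin : ∀ {n} → (Fin n → ℕ) → ℕ
sumFin {n} f = foldr (λ i s → f i + s) 0 (allFin n)

mdeg : ∀ {n} → Monomial n → ℕ
mdeg α = sumFin (λ i → sumFin (λ j → α i j))

𝔪 : ∀ {n} → (Fin n → Fin n) → Monomial n
𝔪 w i j with i <?ᶠ j | w i ≟ j
... | yes _ | yes _ = 1
... | _     | _     = 0

module _ {c ℓ} (K : CharZeroField c ℓ) where
  open CharZeroField K renaming (_+_ to _+K_)

  Poly : ℕ → Set c
  Poly n = List (Carrier × Monomial n)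

  DegLe : ∀ {n} → Poly n → ℕ → Set c
  DegLe f d = All (λ t → mdeg (proj₂ t) ≤ d) f

  pow : Carrier → ℕ → Carrier
  pow x zero    = 1#
  pow x (suc k) = x * pow x k

  prodFin : ∀ {n} → (Fin n → Carrier) → Carrier
  prodFin {n} f = foldr (λ i p → f i * p) 1# (allFin n)

  sumK : ∀ {a} {A : Set a} → (A → Carrier) → List A → Carrier
  sumK g xs = foldr (λ x s → g x +K s) 0# xs

  evalMono : ∀ {n} → Monomial n → (Fin n → Fin n → Carrier) → Carrier
  evalMono α X = prodFin (λ i → prodFin (λ j → pow (X i j) (α i j)))

  eval : ∀ {n} → Poly n → (Fin n → Fin n → Carrier) → Carrier
  eval f X = sumK (λ t → proj₁ t * evalMono (proj₂ t) X) f

  permMatrix : ∀ {n} → (Fin n → Fin n) → Fin n → Fin n → Carrier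
  permMatrix w i j with w i ≟ j
  ... | yes _ = 1#
  ... | no  _ = 0#

{-# OPTIONS --safe #-}
-- Every involution with a fixed points has m = (n - a)/2 two-cycles. On the permutation matrix of an
-- involution, and for i < j, x_ij·𝔪(w) equals 𝔪(w) if (i j) is a two-cycle of w, 𝔪(w·(i j)) if i and j
-- are fixed by w, and 0 otherwise. Summing over i < j, where Σ x_ij = m, gives (m - p)·𝔪(w) = Σ 𝔪(w·(i j))
-- for w with p two-cycles; in characteristic 0 this rewrites every 𝔪(w) with p ≤ d through 𝔪's with
-- exactly d two-cycles. A monomial is absorbed into 𝔪(w) one variable at a time: off-diagonal variables
-- by the trichotomy above, diagonal ones through x_ii = 1 - Σ_{j≠i} x_ij, each step adding at most one
-- two-cycle to w, so a monomial of degree ≤ d never pushes w beyond d two-cycles.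
module Submission where

open import Defs
open import Level using (_⊔_)
open import Algebra.Bundles using (CommutativeMonoid; Semiring; CommutativeRing)
import Algebra.Properties.CommutativeMonoid.Sum as CommutativeMonoidSum
import Algebra.Properties.Semiring.Sum as SemiringSum
import Algebra.Properties.Group as GroupProperties
import Algebra.Properties.Ring as RingProperties
open import Data.Nat as ℕ using (ℕ; zero; suc; _≤_; _∸_)
import Data.Nat.Properties as ℕP
open import Data.Nat.DivMod using (_/_; m*n/n≡m)
open import Data.Nat.Divisibility using (_∣_; divides)
open import Data.Fin using (Fin; zero; suc; punchIn) renaming (_<_ to _<ᶠ_)
open import Data.Fin.Permutation using (permutation)
open import Data.Fin.Permutation.Components using (transpose)
open import Data.Fin.Properties using (_≟_; <-cmp; <-irrefl; <-asym; <⇒≢; punchInᵢ≢i) renaming (_<?_ to _<ᶠ?_)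
open import Data.List using (List; []; _∷_; _++_; map; foldr; filter; length; tabulate; allFin)
open import Data.List.Properties using (filter-none)
open import Data.List.Relation.Unary.All using (All; []; _∷_; universal)
import Data.List.Relation.Unary.All.Properties as All
open import Data.Product using (Σ; _×_; _,_; proj₁; proj₂)
open import Data.Vec.Functional using (Vector; removeAt)
open import Function using (_∘_; id; flip)
open import Relation.Binary.Definitions using (tri<; tri≈; tri>)
open import Relation.Binary.PropositionalEquality as ≡ using (_≡_; _≢_; refl; cong; cong₂)
open import Relation.Nullary using (Dec; yes; no; ¬_; ¬?; contradiction)
open import Relation.Nullary.Decidable using (dec-true; dec-false)
open import Relation.Unary using (Pred; Decidable)
import Relation.Binary.Reasoning.Setoid as SetoidReasoning

module _ {a ℓ} (M : CommutativeMonoid a ℓ) where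
  open CommutativeMonoid M renaming (refl to ≈-refl)
  open CommutativeMonoidSum M
  open SetoidReasoning setoid

  foldr-tabulate : ∀ {b} {B : Set b} {n} (f : B → Carrier) (h : Fin n → B) →
    foldr (λ x s → f x ∙ s) ε (tabulate h) ≡ sum (f ∘ h)
  foldr-tabulate {n = zero}  f h = refl
  foldr-tabulate {n = suc n} f h = cong (f (h zero) ∙_) (foldr-tabulate f (h ∘ suc))

  sum-update : ∀ {n} {f g : Vector Carrier n} (i : Fin n) {c : Carrier} →
    (∀ k → k ≢ i → f k ≈ g k) → f i ≈ c ∙ g i → sum f ≈ c ∙ sum g
  sum-update {suc n} {f} {g} i {c} f≈g fi≈cgi = begin
    sum f                          ≈⟨ sum-remove f ⟩
    f i ∙ sum (removeAt f i)       ≈⟨ ∙-cong fi≈cgi (sum-cong-≋ (λ k → f≈g (punchIn i k) (punchInᵢ≢i i k))) ⟩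
    (c ∙ g i) ∙ sum (removeAt g i) ≈⟨ assoc c (g i) _ ⟩
    c ∙ (g i ∙ sum (removeAt g i)) ≈⟨ ∙-congˡ (sum-remove g) ⟨
    c ∙ sum g                      ∎

  sum-single : ∀ {n} {f : Vector Carrier n} (i : Fin n) → (∀ k → k ≢ i → f k ≈ ε) → sum f ≈ f i
  sum-single {n} {f} i f≈ε = begin
    sum f                   ≈⟨ sum-update i f≈ε (sym (identityʳ (f i))) ⟩
    f i ∙ sum {n} (λ _ → ε) ≈⟨ ∙-congˡ (sum-replicate-zero n) ⟩
    f i ∙ ε                 ≈⟨ identityʳ (f i) ⟩
    f i                     ∎

  sum-∘-involution : ∀ {n} (f : Vector Carrier n) {σ : Fin n → Fin n} → IsInvolution σ → sum (f ∘ σ) ≈ sum f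
  sum-∘-involution f σ² = sym (sum-permute f (permutation _ _ σ² σ²))

module Indicator {a ℓ} (S : Semiring a ℓ) where
  open Semiring S using (Carrier; 0#; 1#)

  𝟙 : ∀ {p} {P : Set p} → Dec P → Carrier
  𝟙 (yes _) = 1#
  𝟙 (no _)  = 0#

  𝟙-yes : ∀ {p} {P : Set p} (P? : Dec P) → P → 𝟙 P? ≡ 1#
  𝟙-yes (yes _) _  = refl
  𝟙-yes (no ¬p) p = contradiction p ¬p

  𝟙-no : ∀ {p} {P : Set p} (P? : Dec P) → ¬ P → 𝟙 P? ≡ 0#
  𝟙-no (yes p) ¬p = contradiction p ¬p
  𝟙-no (no _)  _  = refl

module CommutativeRingLemmas {c ℓ} (R : CommutativeRing c ℓ) where
  open CommutativeRing R hiding (zero) renaming (refl to ≈-refl)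
  open SemiringSum semiring
  open Indicator semiring
  open SetoidReasoning setoid
  module Π = CommutativeMonoidSum *-commutativeMonoid

  ∏ : ∀ {n} → (Fin n → Carrier) → Carrier
  ∏ = Π.sum

  natCast-+ : ∀ x y → natCast R (x ℕ.+ y) ≈ natCast R x + natCast R y
  natCast-+ zero    y = sym (+-identityˡ _)
  natCast-+ (suc x) y = trans (+-congˡ (natCast-+ x y)) (sym (+-assoc _ _ _))

  natCast-length-filter : ∀ {a p} {A : Set a} {P : Pred A p} (P? : Decidable P) {n} (h : Fin n → A) →
    natCast R (length (filter P? (tabulate h))) ≈ sum (λ i → 𝟙 (P? (h i)))
  natCast-length-filter P? {zero}  h = ≈-refl
  natCast-length-filter P? {suc n} h with P? (h zero)
  ... | yes _ = +-congˡ (natCast-length-filter P? (h ∘ suc))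
  ... | no _  = trans (natCast-length-filter P? (h ∘ suc)) (sym (+-identityˡ _))

  sum-split-at : ∀ {n} (f : Fin n → Carrier) i → sum f ≈ f i + sum (λ j → 𝟙 (¬? (j ≟ i)) * f j)
  sum-split-at f i = sum-update +-commutativeMonoid i kept dropped
    where
    kept : ∀ j → j ≢ i → f j ≈ 𝟙 (¬? (j ≟ i)) * f j
    kept j j≢i = sym (trans (*-congʳ (reflexive (𝟙-yes (¬? (j ≟ i)) j≢i))) (*-identityˡ (f j)))
    dropped : f i ≈ f i + 𝟙 (¬? (i ≟ i)) * f i
    dropped = sym (trans (+-congˡ (trans (*-congʳ (reflexive (𝟙-no (¬? (i ≟ i)) (λ i≢i → i≢i refl))))
                                         (zeroˡ (f i))))
                         (+-identityʳ (f i)))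

  ∏-zero : ∀ {n} {f : Fin n → Carrier} i → f i ≈ 0# → ∏ f ≈ 0#
  ∏-zero {suc n} {f} i fi≈0 = begin
    ∏ f                    ≈⟨ Π.sum-remove f ⟩
    f i * ∏ (removeAt f i) ≈⟨ *-congʳ fi≈0 ⟩
    0# * ∏ (removeAt f i)  ≈⟨ zeroˡ _ ⟩
    0#                     ∎

  x*a≈b⇒a≈y*b : ∀ {x y a b} → x * y ≈ 1# → x * a ≈ b → a ≈ y * b
  x*a≈b⇒a≈y*b {x} {y} {a} {b} xy≈1 xa≈b = begin
    a           ≈⟨ *-identityˡ a ⟨
    1# * a      ≈⟨ *-congʳ (trans (*-comm y x) xy≈1) ⟨
    (y * x) * a ≈⟨ *-assoc y x a ⟩
    y * (x * a) ≈⟨ *-congˡ xa≈b ⟩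
    y * b       ∎

module Involutions where
  open import Data.Nat using (_+_; _*_)
  open CommutativeMonoidSum ℕP.+-0-commutativeMonoid using (sum; sum-cong-≗; ∑-distrib-+)
  open Indicator ℕP.+-*-semiring renaming (𝟙 to 𝟙ℕ; 𝟙-yes to 𝟙ℕ-yes; 𝟙-no to 𝟙ℕ-no)
  open ≡ using (sym; trans; subst)
  open ≡.≡-Reasoning

  length-filter-tabulate : ∀ {a p} {A : Set a} {P : Pred A p} (P? : Decidable P) {n} (h : Fin n → A) →
    length (filter P? (tabulate h)) ≡ sum (λ i → 𝟙ℕ (P? (h i)))
  length-filter-tabulate P? {zero}  h = refl
  length-filter-tabulate P? {suc n} h with P? (h zero)
  ... | yes _ = cong suc (length-filter-tabulate P? (h ∘ suc))
  ... | no _  = length-filter-tabulate P? (h ∘ suc)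

  sum-ones : ∀ n → sum {n} (λ _ → 1) ≡ n
  sum-ones zero    = refl
  sum-ones (suc n) = cong suc (sum-ones n)

  fixedPoints+2*twoCycles : ∀ {n} {v : Fin n → Fin n} → IsInvolution v → fixedPoints v + 2 * twoCycles v ≡ n
  fixedPoints+2*twoCycles {n} {v} v² = begin
    fixedPoints v + 2 * twoCycles v     ≡⟨ cong₂ (λ f t → f + 2 * t) (length-filter-tabulate (λ i → v i ≟ i) id)
                                                                   (length-filter-tabulate (λ i → i <ᶠ? v i) id) ⟩
    sum fix + 2 * sum up                ≡⟨ cong (λ t → sum fix + (sum up + t))
                                                 (trans (ℕP.+-identityʳ _) (sym ∑down≡∑up)) ⟩
    sum fix + (sum up + sum down)       ≡⟨ cong (sum fix +_) (∑-distrib-+ up down) ⟨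
    sum fix + sum (λ i → up i + down i) ≡⟨ ∑-distrib-+ fix (λ i → up i + down i) ⟨
    sum (λ i → fix i + (up i + down i)) ≡⟨ sum-cong-≗ trichotomy ⟩
    sum {n} (λ _ → 1)                   ≡⟨ sum-ones n ⟩
    n                                   ∎
    where
    fix up down : Fin n → ℕ
    fix  i = 𝟙ℕ (v i ≟ i)
    up   i = 𝟙ℕ (i <ᶠ? v i)
    down i = 𝟙ℕ (v i <ᶠ? i)
    ∑down≡∑up : sum down ≡ sum up
    ∑down≡∑up = trans (sum-cong-≗ (λ i → cong (λ k → 𝟙ℕ (v i <ᶠ? k)) (sym (v² i))))
                      (sum-∘-involution ℕP.+-0-commutativeMonoid up v²)
    trichotomy : ∀ i → fix i + (up i + down i) ≡ 1
    trichotomy i with <-cmp i (v i)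
    ... | tri< i<vi _ _ = cong₂ _+_ (𝟙ℕ-no (v i ≟ i) (<⇒≢ i<vi ∘ sym))
                            (cong₂ _+_ (𝟙ℕ-yes (i <ᶠ? v i) i<vi) (𝟙ℕ-no (v i <ᶠ? i) (<-asym i<vi)))
    ... | tri≈ _ i≡vi _ = cong₂ _+_ (𝟙ℕ-yes (v i ≟ i) (sym i≡vi))
                            (cong₂ _+_ (𝟙ℕ-no (i <ᶠ? v i) (<-irrefl i≡vi))
                                       (𝟙ℕ-no (v i <ᶠ? i) (<-irrefl (sym i≡vi))))
    ... | tri> _ _ vi<i = cong₂ _+_ (𝟙ℕ-no (v i ≟ i) (<⇒≢ vi<i))
                            (cong₂ _+_ (𝟙ℕ-no (i <ᶠ? v i) (<-asym vi<i)) (𝟙ℕ-yes (v i <ᶠ? i) vi<i))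

  n∸fixedPoints≡q*2⇒twoCycles≡q : ∀ {n q} {v : Fin n → Fin n} → IsInvolution v →
    n ∸ fixedPoints v ≡ q * 2 → twoCycles v ≡ q
  n∸fixedPoints≡q*2⇒twoCycles≡q {n} {q} {v} v² n∸fp≡q*2 = ℕP.*-cancelˡ-≡ (twoCycles v) q 2 (begin
    2 * twoCycles v                                  ≡⟨ ℕP.m+n∸m≡n (fixedPoints v) _ ⟨
    fixedPoints v + 2 * twoCycles v ∸ fixedPoints v ≡⟨ cong (_∸ fixedPoints v) (fixedPoints+2*twoCycles v²) ⟩
    n ∸ fixedPoints v                                ≡⟨ n∸fp≡q*2 ⟩
    q * 2                                            ≡⟨ ℕP.*-comm q 2 ⟩
    2 * q                                            ∎)

  m+1+n≤o⇒m+n≤o : ∀ m {n o} → m + suc n ≤ o → m + n ≤ o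
  m+1+n≤o⇒m+n≤o m {n} = ℕP.≤-trans (ℕP.+-monoʳ-≤ m (ℕP.n≤1+n n))

  twoCycles-id : ∀ {n} → twoCycles {n} id ≡ 0
  twoCycles-id {n} = cong length (filter-none (λ i → i <ᶠ? i) (universal (λ i → <-irrefl refl) (allFin n)))

  transpose-matchˡ : ∀ {n} (i j : Fin n) → transpose i j i ≡ j
  transpose-matchˡ i j rewrite dec-true (i ≟ i) refl = refl

  transpose-matchʳ : ∀ {n} (i j : Fin n) → transpose i j j ≡ i
  transpose-matchʳ i j with i ≟ j
  ... | yes refl rewrite dec-true (i ≟ i) refl = refl
  ... | no i≢j rewrite dec-false (j ≟ i) (i≢j ∘ sym) | dec-true (j ≟ j) refl = refl

  transpose-other : ∀ {n} {i j k : Fin n} → k ≢ i → k ≢ j → transpose i j k ≡ k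
  transpose-other {i = i} {j} {k} k≢i k≢j rewrite dec-false (k ≟ i) k≢i | dec-false (k ≟ j) k≢j = refl

  involution-injective : ∀ {n} {w : Fin n → Fin n} → IsInvolution w → ∀ {k l} → w k ≡ w l → k ≡ l
  involution-injective {w = w} w² {k} {l} wk≡wl = trans (sym (w² k)) (trans (cong w wk≡wl) (w² l))

  𝔪-edge : ∀ {n} {w : Fin n → Fin n} {i j} → i <ᶠ j → w i ≡ j → 𝔪 w i j ≡ 1
  𝔪-edge {w = w} {i} {j} i<j wi≡j with i <ᶠ? j | w i ≟ j
  ... | yes _  | yes _    = refl
  ... | no i≮j | _        = contradiction i<j i≮j
  ... | yes _  | no wi≢j = contradiction wi≡j wi≢j

  𝔪-nonedge : ∀ {n} {w : Fin n → Fin n} {i j} → (i <ᶠ j → w i ≢ j) → 𝔪 w i j ≡ 0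
  𝔪-nonedge {w = w} {i} {j} nonedge with i <ᶠ? j | w i ≟ j
  ... | yes i<j | yes wi≡j = contradiction wi≡j (nonedge i<j)
  ... | yes _   | no _     = refl
  ... | no _    | _        = refl

  𝔪-cong : ∀ {n} {w w′ : Fin n → Fin n} {i} j → w i ≡ w′ i → 𝔪 w i j ≡ 𝔪 w′ i j
  𝔪-cong {w = w} {w′} {i} j wi≡w′i with i <ᶠ? j | w i ≟ j | w′ i ≟ j
  ... | no _  | _         | _          = refl
  ... | yes _ | yes _     | yes _      = refl
  ... | yes _ | no _      | no _       = refl
  ... | yes _ | yes wi≡j  | no w′i≢j  = contradiction (trans (sym wi≡w′i) wi≡j) w′i≢j
  ... | yes _ | no wi≢j   | yes w′i≡j = contradiction (trans wi≡w′i w′i≡j) wi≢j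

  module _ {n} {w : Fin n → Fin n} {i j : Fin n} (w² : IsInvolution w) (wi≡i : w i ≡ i) (wj≡j : w j ≡ j) where

    ∘transpose-at-i : w (transpose i j i) ≡ j
    ∘transpose-at-i = trans (cong w (transpose-matchˡ i j)) wj≡j

    ∘transpose-at-j : w (transpose i j j) ≡ i
    ∘transpose-at-j = trans (cong w (transpose-matchʳ i j)) wi≡i

    ∘transpose-involution : IsInvolution (w ∘ transpose i j)
    ∘transpose-involution k = cases (k ≟ i) (k ≟ j)
      where
      cases : Dec (k ≡ i) → Dec (k ≡ j) → w (transpose i j (w (transpose i j k))) ≡ k
      cases (yes refl) _       rewrite ∘transpose-at-i = ∘transpose-at-j
      cases (no _) (yes refl) rewrite ∘transpose-at-j = ∘transpose-at-i
      cases (no k≢i) (no k≢j) rewrite transpose-other k≢i k≢j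
                                    | transpose-other (k≢i ∘ involution-injective w² ∘ flip trans (sym wi≡i))
                                                      (k≢j ∘ involution-injective w² ∘ flip trans (sym wj≡j)) = w² k

    module _ (i<j : i <ᶠ j) where

      twoCycles-∘transpose : twoCycles (w ∘ transpose i j) ≡ suc (twoCycles w)
      twoCycles-∘transpose = begin
        twoCycles (w ∘ transpose i j)             ≡⟨ length-filter-tabulate (λ k → k <ᶠ? w (transpose i j k)) id ⟩
        sum (λ k → 𝟙ℕ (k <ᶠ? w (transpose i j k))) ≡⟨ sum-update ℕP.+-0-commutativeMonoid i unchanged raised ⟩
        suc (sum (λ k → 𝟙ℕ (k <ᶠ? w k)))          ≡⟨ cong suc (length-filter-tabulate (λ k → k <ᶠ? w k) id) ⟨
        suc (twoCycles w)                          ∎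
        where
        unchanged : ∀ k → k ≢ i → 𝟙ℕ (k <ᶠ? w (transpose i j k)) ≡ 𝟙ℕ (k <ᶠ? w k)
        unchanged k k≢i with k ≟ j
        ... | yes refl = trans (𝟙ℕ-no (k <ᶠ? w (transpose i k k)) (<-asym i<j ∘ subst (k <ᶠ_) ∘transpose-at-j))
                               (sym (𝟙ℕ-no (k <ᶠ? w k) (<-irrefl (sym wj≡j))))
        ... | no k≢j   = cong (λ l → 𝟙ℕ (k <ᶠ? w l)) (transpose-other k≢i k≢j)
        raised : 𝟙ℕ (i <ᶠ? w (transpose i j i)) ≡ 1 + 𝟙ℕ (i <ᶠ? w i)
        raised = trans (𝟙ℕ-yes (i <ᶠ? w (transpose i j i)) (subst (i <ᶠ_) (sym ∘transpose-at-i) i<j))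
                       (cong (1 +_) (sym (𝟙ℕ-no (i <ᶠ? w i) (<-irrefl (sym wi≡i)))))

      twoCycles-∘transpose-+ : ∀ k → twoCycles (w ∘ transpose i j) + k ≡ twoCycles w + suc k
      twoCycles-∘transpose-+ k = trans (cong (_+ k) twoCycles-∘transpose) (sym (ℕP.+-suc (twoCycles w) k))

      𝔪-∘transpose-off-row : ∀ k l → k ≢ i → 𝔪 (w ∘ transpose i j) k l ≡ 𝔪 w k l
      𝔪-∘transpose-off-row k l k≢i with k ≟ j
      ... | yes refl = trans (𝔪-nonedge (λ k<l wτk≡l →
                                   <-asym i<j (subst (k <ᶠ_) (trans (sym wτk≡l) ∘transpose-at-j) k<l)))
                             (sym (𝔪-nonedge (λ k<l wk≡l → <⇒≢ k<l (trans (sym wj≡j) wk≡l))))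
      ... | no k≢j   = 𝔪-cong l (cong w (transpose-other k≢i k≢j))

      𝔪-∘transpose-row : ∀ l → l ≢ j → 𝔪 (w ∘ transpose i j) i l ≡ 𝔪 w i l
      𝔪-∘transpose-row l l≢j = trans (𝔪-nonedge (λ _ wτi≡l → l≢j (trans (sym wτi≡l) ∘transpose-at-i)))
                                     (sym (𝔪-nonedge (λ i<l wi≡l → <⇒≢ i<l (trans (sym wi≡i) wi≡l))))

      𝔪-∘transpose-entry : 𝔪 (w ∘ transpose i j) i j ≡ suc (𝔪 w i j)
      𝔪-∘transpose-entry = trans (𝔪-edge i<j ∘transpose-at-i)
                                 (cong suc (sym (𝔪-nonedge (λ _ wi≡j → <⇒≢ i<j (trans (sym wi≡i) wi≡j)))))

open Involutions

module Evaluation {c ℓ} (K : CharZeroField c ℓ) where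
  open CharZeroField K hiding (zero) renaming (refl to ≈-refl)
  open SemiringSum semiring
  open Indicator semiring
  open CommutativeRingLemmas commutativeRing
  open GroupProperties +-group using (∙-cancelʳ)
  open SetoidReasoning setoid

  ι : ℕ → Carrier
  ι = natCast commutativeRing

  powers : ∀ {n} → Monomial n → (Fin n → Fin n → Carrier) → Fin n → Fin n → Carrier
  powers α X k l = pow K (X k l) (α k l)

  evalMono-∏ : ∀ {n} (α : Monomial n) X → evalMono K α X ≡ ∏ (λ k → ∏ (powers α X k))
  evalMono-∏ {n} α X = ≡.trans (foldr-tabulate *-commutativeMonoid {n = n} (λ k → prodFin K (powers α X k)) id)
                               (Π.sum-cong-≗ (λ k → foldr-tabulate *-commutativeMonoid {n = n} (powers α X k) id))

  evalMono-vanishes : ∀ {n} (α : Monomial n) X {i j e} → α i j ≡ suc e → X i j ≈ 0# → evalMono K α X ≈ 0#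
  evalMono-vanishes α X {i} {j} {e} αij≡1+e Xij≈0 = begin
    evalMono K α X               ≡⟨ evalMono-∏ α X ⟩
    ∏ (λ k → ∏ (powers α X k))   ≈⟨ ∏-zero i (∏-zero j factor-vanishes) ⟩
    0#                           ∎
    where
    factor-vanishes : powers α X i j ≈ 0#
    factor-vanishes = begin
      pow K (X i j) (α i j)   ≡⟨ cong (pow K (X i j)) αij≡1+e ⟩
      X i j * pow K (X i j) e ≈⟨ *-congʳ Xij≈0 ⟩
      0# * pow K (X i j) e    ≈⟨ zeroˡ _ ⟩
      0#                      ∎

  evalMono-increment : ∀ {n} (α β : Monomial n) X {i j} →
    (∀ k l → k ≢ i → β k l ≡ α k l) → (∀ l → l ≢ j → β i l ≡ α i l) → β i j ≡ suc (α i j) →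
    evalMono K β X ≈ X i j * evalMono K α X
  evalMono-increment α β X {i} {j} off-row row entry = begin
    evalMono K β X                     ≡⟨ evalMono-∏ β X ⟩
    ∏ (λ k → ∏ (powers β X k))         ≈⟨ sum-update *-commutativeMonoid i
                                            (λ k k≢i → Π.sum-cong-≋ (λ l → pow-cong (off-row k l k≢i)))
                                            (sum-update *-commutativeMonoid j
                                              (λ l l≢j → pow-cong (row l l≢j)) (pow-cong entry)) ⟩
    X i j * ∏ (λ k → ∏ (powers α X k)) ≡⟨ cong (X i j *_) (evalMono-∏ α X) ⟨
    X i j * evalMono K α X             ∎
    where
    pow-cong : ∀ {k l e e′} → e ≡ e′ → pow K (X k l) e ≈ pow K (X k l) e′
    pow-cong = reflexive ∘ cong (pow K _)

  evalMono-constant : ∀ {n} (α : Monomial n) X → (∀ k l → α k l ≡ 0) → evalMono K α X ≈ 1#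
  evalMono-constant {n} α X α≡0 = begin
    evalMono K α X             ≡⟨ evalMono-∏ α X ⟩
    ∏ (λ k → ∏ (powers α X k)) ≈⟨ Π.sum-cong-≋ (λ k → trans (Π.sum-cong-≋ (pow-zero k)) (Π.sum-replicate-zero n)) ⟩
    ∏ {n} (λ _ → 1#)           ≈⟨ Π.sum-replicate-zero n ⟩
    1#                         ∎
    where
    pow-zero : ∀ k l → powers α X k l ≈ 1#
    pow-zero k l = reflexive (cong (pow K (X k l)) (α≡0 k l))

  permMatrix-≡ : ∀ {n} (v : Fin n → Fin n) {i j} → v i ≡ j → permMatrix K v i j ≡ 1#
  permMatrix-≡ v {i} {j} vi≡j with v i ≟ j
  ... | yes _    = refl
  ... | no vi≢j = contradiction vi≡j vi≢j

  permMatrix-≢ : ∀ {n} (v : Fin n → Fin n) {i j} → v i ≢ j → permMatrix K v i j ≡ 0#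
  permMatrix-≢ v {i} {j} vi≢j with v i ≟ j
  ... | yes vi≡j = contradiction vi≡j vi≢j
  ... | no _     = refl

  permMatrix≡𝟙 : ∀ {n} (v : Fin n → Fin n) i j → permMatrix K v i j ≡ 𝟙 (v i ≟ j)
  permMatrix≡𝟙 v i j with v i ≟ j
  ... | yes _ = refl
  ... | no _  = refl

  permMatrix-sym : ∀ {n} {v : Fin n → Fin n} → IsInvolution v → ∀ i j → permMatrix K v i j ≡ permMatrix K v j i
  permMatrix-sym {v = v} v² i j with v i ≟ j | v j ≟ i
  ... | yes _    | yes _    = refl
  ... | no _     | no _     = refl
  ... | yes vi≡j | no vj≢i = contradiction (≡.trans (cong v (≡.sym vi≡j)) (v² i)) vj≢i
  ... | no vi≢j | yes vj≡i = contradiction (≡.trans (cong v (≡.sym vj≡i)) (v² j)) vi≢j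

  permMatrix-row-sum : ∀ {n} (v : Fin n → Fin n) i → sum (permMatrix K v i) ≈ 1#
  permMatrix-row-sum v i = trans (sum-single +-commutativeMonoid (v i) off-vi) (reflexive (permMatrix-≡ v refl))
    where
    off-vi : ∀ j → j ≢ v i → permMatrix K v i j ≈ 0#
    off-vi j j≢vi = reflexive (permMatrix-≢ v (j≢vi ∘ ≡.sym))

  permMatrix-diagonal : ∀ {n} (v : Fin n → Fin n) i →
    permMatrix K v i i + sum (λ j → 𝟙 (¬? (j ≟ i)) * permMatrix K v i j) ≈ 1#
  permMatrix-diagonal v i = trans (sym (sum-split-at (permMatrix K v i) i)) (permMatrix-row-sum v i)

  upperSum : ∀ {n} → (Fin n → Fin n → Carrier) → Carrier
  upperSum A = sum (λ i → sum (λ j → 𝟙 (i <ᶠ? j) * A i j))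

  upperSum-permMatrix : ∀ {n} (v : Fin n → Fin n) → upperSum (permMatrix K v) ≈ ι (twoCycles v)
  upperSum-permMatrix v = trans (sum-cong-≋ row) (sym (natCast-length-filter (λ i → i <ᶠ? v i) id))
    where
    row : ∀ i → sum (λ j → 𝟙 (i <ᶠ? j) * permMatrix K v i j) ≈ 𝟙 (i <ᶠ? v i)
    row i = begin
      sum (λ j → 𝟙 (i <ᶠ? j) * permMatrix K v i j) ≈⟨ sum-single +-commutativeMonoid (v i) off-vi ⟩
      𝟙 (i <ᶠ? v i) * permMatrix K v i (v i)       ≈⟨ *-congˡ (reflexive (permMatrix-≡ v refl)) ⟩
      𝟙 (i <ᶠ? v i) * 1#                           ≈⟨ *-identityʳ _ ⟩
      𝟙 (i <ᶠ? v i)                                ∎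
      where
      off-vi : ∀ j → j ≢ v i → 𝟙 (i <ᶠ? j) * permMatrix K v i j ≈ 0#
      off-vi j j≢vi = trans (*-congˡ (reflexive (permMatrix-≢ v (j≢vi ∘ ≡.sym)))) (zeroʳ _)

  upperSum-cong : ∀ {n} {A B : Fin n → Fin n → Carrier} →
    (∀ {i j} → i <ᶠ j → A i j ≈ B i j) → upperSum A ≈ upperSum B
  upperSum-cong {A = A} {B} A≈B = sum-cong-≋ (λ i → sum-cong-≋ (λ j → entry (i <ᶠ? j)))
    where
    entry : ∀ {i j} (i<?j : Dec (i <ᶠ j)) → 𝟙 i<?j * A i j ≈ 𝟙 i<?j * B i j
    entry (yes i<j) = *-congˡ (A≈B i<j)
    entry (no _)    = trans (zeroˡ _) (sym (zeroˡ _))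

  upperSum-+ : ∀ {n} (A B : Fin n → Fin n → Carrier) →
    upperSum (λ i j → A i j + B i j) ≈ upperSum A + upperSum B
  upperSum-+ {n} A B = begin
    upperSum (λ i j → A i j + B i j)                      ≈⟨ sum-cong-≋ (λ i → sum-cong-≋ (λ j → distribˡ (u i j) (A i j) (B i j))) ⟩
    sum (λ i → sum (λ j → u i j * A i j + u i j * B i j)) ≈⟨ sum-cong-≋ (λ i → ∑-distrib-+ (uA i) (uB i)) ⟩
    sum (λ i → sum (uA i) + sum (uB i))                   ≈⟨ ∑-distrib-+ (λ i → sum (uA i)) (λ i → sum (uB i)) ⟩
    upperSum A + upperSum B                               ∎
    where
    u uA uB : Fin n → Fin n → Carrier
    u i j = 𝟙 (i <ᶠ? j)
    uA i j = u i j * A i j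
    uB i j = u i j * B i j

  upperSum-*ʳ : ∀ {n} (A : Fin n → Fin n → Carrier) x → upperSum (λ i j → A i j * x) ≈ upperSum A * x
  upperSum-*ʳ {n} A x = begin
    upperSum (λ i j → A i j * x)         ≈⟨ sum-cong-≋ (λ i → sum-cong-≋ (λ j → *-assoc (𝟙 (i <ᶠ? j)) (A i j) x)) ⟨
    sum (λ i → sum (λ j → uA i j * x))   ≈⟨ sum-cong-≋ (λ i → *-distribʳ-sum x (uA i)) ⟨
    sum (λ i → sum (uA i) * x)           ≈⟨ *-distribʳ-sum x (λ i → sum (uA i)) ⟨
    upperSum A * x                       ∎
    where
    uA : Fin n → Fin n → Carrier
    uA i j = 𝟙 (i <ᶠ? j) * A i j

  eval𝔪 : ∀ {n} → (Fin n → Fin n) → (Fin n → Fin n) → Carrier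
  eval𝔪 w v = evalMono K (𝔪 w) (permMatrix K v)

  adjoined𝔪 : ∀ {n} → (Fin n → Fin n) → Fin n → Fin n → (Fin n → Fin n) → Carrier
  adjoined𝔪 w i j v = 𝟙 (w i ≟ i) * (𝟙 (w j ≟ j) * eval𝔪 (w ∘ transpose i j) v)

  eval𝔪-∘transpose : ∀ {n} {w : Fin n → Fin n} {i j} → IsInvolution w → w i ≡ i → w j ≡ j → i <ᶠ j →
    ∀ X → evalMono K (𝔪 (w ∘ transpose i j)) X ≈ X i j * evalMono K (𝔪 w) X
  eval𝔪-∘transpose w² wi≡i wj≡j i<j X = evalMono-increment _ _ X
    (𝔪-∘transpose-off-row w² wi≡i wj≡j i<j) (𝔪-∘transpose-row w² wi≡i wj≡j i<j)
    (𝔪-∘transpose-entry w² wi≡i wj≡j i<j)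

  module _ {n} {w v : Fin n → Fin n} (w² : IsInvolution w) (v² : IsInvolution v) where

    eval𝔪-vanishes : ∀ {p q} → w p ≡ q → p ≢ q → v p ≢ q → eval𝔪 w v ≈ 0#
    eval𝔪-vanishes {p} {q} wp≡q p≢q vp≢q with <-cmp p q
    ... | tri< p<q _ _ = evalMono-vanishes (𝔪 w) (permMatrix K v) (𝔪-edge p<q wp≡q)
                           (reflexive (permMatrix-≢ v vp≢q))
    ... | tri≈ _ p≡q _ = contradiction p≡q p≢q
    ... | tri> _ _ q<p = evalMono-vanishes (𝔪 w) (permMatrix K v) (𝔪-edge q<p wq≡p)
                           (reflexive (permMatrix-≢ v vq≢p))
      where
      wq≡p : w q ≡ p
      wq≡p = ≡.trans (cong w (≡.sym wp≡q)) (w² p)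
      vq≢p : v q ≢ p
      vq≢p vq≡p = vp≢q (≡.trans (cong v (≡.sym vq≡p)) (v² q))

    permMatrix*-vanishes : ∀ {i j x} → (v i ≡ j → x ≈ 0#) → permMatrix K v i j * x ≈ 0#
    permMatrix*-vanishes {i} {j} {x} x≈0 with v i ≟ j
    ... | yes vi≡j = trans (*-congˡ (x≈0 vi≡j)) (zeroʳ _)
    ... | no _     = zeroˡ x

    permMatrix*eval𝔪-edge : ∀ {i j} → i ≢ j → w i ≡ j → permMatrix K v i j * eval𝔪 w v ≈ eval𝔪 w v
    permMatrix*eval𝔪-edge {i} {j} i≢j wi≡j with v i ≟ j
    ... | yes _    = *-identityˡ _
    ... | no vi≢j = trans (zeroˡ _) (sym (eval𝔪-vanishes wi≡j i≢j vi≢j))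

    permMatrix*eval𝔪-conflictˡ : ∀ {i j} → w i ≢ i → w i ≢ j → permMatrix K v i j * eval𝔪 w v ≈ 0#
    permMatrix*eval𝔪-conflictˡ {i} {j} wi≢i wi≢j = permMatrix*-vanishes λ vi≡j →
      eval𝔪-vanishes refl (wi≢i ∘ ≡.sym) (λ vi≡wi → wi≢j (≡.trans (≡.sym vi≡wi) vi≡j))

    permMatrix*eval𝔪-conflictʳ : ∀ {i j} → w j ≢ j → w i ≢ j → permMatrix K v i j * eval𝔪 w v ≈ 0#
    permMatrix*eval𝔪-conflictʳ {i} {j} wj≢j wi≢j = permMatrix*-vanishes λ vi≡j →
      eval𝔪-vanishes refl (wj≢j ∘ ≡.sym) (λ vj≡wj → wi≢j (wi≡j vi≡j vj≡wj))
      where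
      wi≡j : v i ≡ j → v j ≡ w j → w i ≡ j
      wi≡j vi≡j vj≡wj = ≡.trans (cong w (≡.trans (≡.sym (≡.trans (cong v (≡.sym vi≡j)) (v² i))) vj≡wj)) (w² j)

    permMatrix*eval𝔪 : ∀ {i j} → i <ᶠ j →
      permMatrix K v i j * eval𝔪 w v ≈ permMatrix K w i j * eval𝔪 w v + adjoined𝔪 w i j v
    permMatrix*eval𝔪 {i} {j} i<j = begin
      permMatrix K v i j * e                     ≈⟨ cases (w i ≟ j) (w i ≟ i) (w j ≟ j) ⟩
      𝟙 (w i ≟ j) * e + adjoined𝔪 w i j v        ≡⟨ cong (λ x → x * e + adjoined𝔪 w i j v) (permMatrix≡𝟙 w i j) ⟨
      permMatrix K w i j * e + adjoined𝔪 w i j v ∎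
      where
      e e′ : Carrier
      e  = eval𝔪 w v
      e′ = eval𝔪 (w ∘ transpose i j) v
      cases : (wi≟j : Dec (w i ≡ j)) (wi≟i : Dec (w i ≡ i)) (wj≟j : Dec (w j ≡ j)) →
              permMatrix K v i j * e ≈ 𝟙 wi≟j * e + 𝟙 wi≟i * (𝟙 wj≟j * e′)
      cases (yes wi≡j) (yes wi≡i) _ = contradiction (≡.trans (≡.sym wi≡i) wi≡j) (<⇒≢ i<j)
      cases (yes wi≡j) (no _)     _ = begin
        permMatrix K v i j * e ≈⟨ permMatrix*eval𝔪-edge (<⇒≢ i<j) wi≡j ⟩
        e                      ≈⟨ *-identityˡ e ⟨
        1# * e                 ≈⟨ +-identityʳ _ ⟨
        1# * e + 0#            ≈⟨ +-congˡ (zeroˡ _) ⟨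
        1# * e + 0# * _        ∎
      cases (no _) (yes wi≡i) (yes wj≡j) = begin
        permMatrix K v i j * e  ≈⟨ eval𝔪-∘transpose w² wi≡i wj≡j i<j (permMatrix K v) ⟨
        e′                      ≈⟨ *-identityˡ e′ ⟨
        1# * e′                 ≈⟨ *-identityˡ _ ⟨
        1# * (1# * e′)          ≈⟨ +-identityˡ _ ⟨
        0# + 1# * (1# * e′)     ≈⟨ +-congʳ (zeroˡ e) ⟨
        0# * e + 1# * (1# * e′) ∎
      cases (no wi≢j) (no wi≢i) _ = begin
        permMatrix K v i j * e ≈⟨ permMatrix*eval𝔪-conflictˡ wi≢i wi≢j ⟩
        0#                     ≈⟨ +-identityʳ 0# ⟨
        0# + 0#                ≈⟨ +-cong (zeroˡ e) (zeroˡ _) ⟨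
        0# * e + 0# * _        ∎
      cases (no wi≢j) (yes _) (no wj≢j) = begin
        permMatrix K v i j * e  ≈⟨ permMatrix*eval𝔪-conflictʳ wj≢j wi≢j ⟩
        0#                      ≈⟨ +-identityʳ 0# ⟨
        0# + 0#                 ≈⟨ +-cong (zeroˡ e) (trans (*-identityˡ _) (zeroˡ e′)) ⟨
        0# * e + 1# * (0# * e′) ∎

    twoCycles*eval𝔪 :
      ι (twoCycles v) * eval𝔪 w v ≈ ι (twoCycles w) * eval𝔪 w v + upperSum (λ i j → adjoined𝔪 w i j v)
    twoCycles*eval𝔪 = begin
      ι (twoCycles v) * e                                          ≈⟨ *-congʳ (upperSum-permMatrix v) ⟨
      upperSum (permMatrix K v) * e                                ≈⟨ upperSum-*ʳ (permMatrix K v) e ⟨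
      upperSum (λ i j → permMatrix K v i j * e)                    ≈⟨ upperSum-cong permMatrix*eval𝔪 ⟩
      upperSum (λ i j → permMatrix K w i j * e + adjoined𝔪 w i j v) ≈⟨ upperSum-+ we (λ i j → adjoined𝔪 w i j v) ⟩
      upperSum we + U                                              ≈⟨ +-congʳ (upperSum-*ʳ (permMatrix K w) e) ⟩
      upperSum (permMatrix K w) * e + U                            ≈⟨ +-congʳ (*-congʳ (upperSum-permMatrix w)) ⟩
      ι (twoCycles w) * e + U                                      ∎
      where
      e U : Carrier
      e = eval𝔪 w v
      U = upperSum (λ i j → adjoined𝔪 w i j v)
      we : Fin n → Fin n → Carrier
      we i j = permMatrix K w i j * e

    natCast*eval𝔪 : ∀ r → twoCycles v ≡ suc r ℕ.+ twoCycles w →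
      ι (suc r) * eval𝔪 w v ≈ upperSum (λ i j → adjoined𝔪 w i j v)
    natCast*eval𝔪 r tv≡1+r+tw = ∙-cancelʳ (ι (twoCycles w) * e) _ _ (begin
      ι (suc r) * e + ι (twoCycles w) * e ≈⟨ distribʳ e _ _ ⟨
      (ι (suc r) + ι (twoCycles w)) * e   ≈⟨ *-congʳ (natCast-+ (suc r) (twoCycles w)) ⟨
      ι (suc r ℕ.+ twoCycles w) * e       ≡⟨ cong (λ t → ι t * e) tv≡1+r+tw ⟨
      ι (twoCycles v) * e                 ≈⟨ twoCycles*eval𝔪 ⟩
      ι (twoCycles w) * e + U             ≈⟨ +-comm _ U ⟩
      U + ι (twoCycles w) * e             ∎)
      where
      e U : Carrier
      e = eval𝔪 w v
      U = upperSum (λ i j → adjoined𝔪 w i j v)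

-- A polynomial is determined modulo I(M) by its values on M, so spanning the quotient is expressed for
-- functions on M = {involutions with m two-cycles}; M_{n,a} is the case m = (n - a)/2.
module Spanning {c ℓ} (K : CharZeroField c ℓ) (n m d : ℕ) where
  open CharZeroField K hiding (zero) renaming (refl to ≈-refl)
  open SemiringSum semiring using (sum; sum-cong-≋; *-distribˡ-sum; *-distribʳ-sum)
  open Indicator semiring
  open CommutativeRingLemmas commutativeRing using (x*a≈b⇒a≈y*b)
  open GroupProperties +-group using (x≈z//y)
  open RingProperties ring using (-1*x≈-x)
  open Evaluation K
  open SetoidReasoning setoid

  combination : List (Carrier × (Fin n → Fin n)) → (Fin n → Fin n) → Carrier
  combination comb v = sumK K (λ t → proj₁ t * eval𝔪 (proj₂ t) v) comb

  Spanned : ((Fin n → Fin n) → Carrier) → Set (c ⊔ ℓ)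
  Spanned g = Σ (List (Carrier × (Fin n → Fin n))) λ comb →
    All (λ t → IsInvolution (proj₂ t) × twoCycles (proj₂ t) ≡ d) comb ×
    (∀ v → IsInvolution v → twoCycles v ≡ m → g v ≈ combination comb v)

  Spanned-resp : ∀ {g h} → (∀ v → IsInvolution v → twoCycles v ≡ m → g v ≈ h v) → Spanned h → Spanned g
  Spanned-resp g≈h (comb , good , h≈comb) = comb , good , λ v v² tv → trans (g≈h v v² tv) (h≈comb v v² tv)

  Spanned-0# : Spanned (λ _ → 0#)
  Spanned-0# = [] , [] , λ _ _ _ → ≈-refl

  Spanned-eval𝔪 : ∀ {w} → IsInvolution w → twoCycles w ≡ d → Spanned (eval𝔪 w)
  Spanned-eval𝔪 {w} w² tw≡d =
    (1# , w) ∷ [] , (w² , tw≡d) ∷ [] , λ v _ _ → sym (trans (+-identityʳ _) (*-identityˡ _))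

  combination-++ : ∀ xs ys v → combination (xs ++ ys) v ≈ combination xs v + combination ys v
  combination-++ []       ys v = sym (+-identityˡ _)
  combination-++ (t ∷ xs) ys v = trans (+-congˡ (combination-++ xs ys v)) (sym (+-assoc _ _ _))

  Spanned-+ : ∀ {g h} → Spanned g → Spanned h → Spanned (λ v → g v + h v)
  Spanned-+ (xs , xs-good , g≈xs) (ys , ys-good , h≈ys) = xs ++ ys , All.++⁺ xs-good ys-good ,
    λ v v² tv → trans (+-cong (g≈xs v v² tv) (h≈ys v v² tv)) (sym (combination-++ xs ys v))

  scaleBy : Carrier → Carrier × (Fin n → Fin n) → Carrier × (Fin n → Fin n)
  scaleBy x (a , w) = x * a , w

  combination-scaleBy : ∀ x xs v → combination (map (scaleBy x) xs) v ≈ x * combination xs v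
  combination-scaleBy x []       v = sym (zeroʳ x)
  combination-scaleBy x (t ∷ xs) v = trans (+-cong (*-assoc _ _ _) (combination-scaleBy x xs v)) (sym (distribˡ x _ _))

  Spanned-scale : ∀ x {g} → Spanned g → Spanned (λ v → x * g v)
  Spanned-scale x (xs , good , g≈xs) = map (scaleBy x) xs , All.map⁺ good ,
    λ v v² tv → trans (*-congˡ (g≈xs v v² tv)) (sym (combination-scaleBy x xs v))

  Spanned-neg : ∀ {g} → Spanned g → Spanned (λ v → - g v)
  Spanned-neg g-spanned = Spanned-resp (λ v _ _ → sym (-1*x≈-x _)) (Spanned-scale (- 1#) g-spanned)

  Spanned-sum : ∀ {k} {g : Fin k → (Fin n → Fin n) → Carrier} →
    (∀ i → Spanned (g i)) → Spanned (λ v → sum (λ i → g i v))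
  Spanned-sum {zero}  g-spanned = Spanned-0#
  Spanned-sum {suc k} g-spanned = Spanned-+ (g-spanned zero) (Spanned-sum (g-spanned ∘ suc))

  Spanned-𝟙 : ∀ {p} {P : Set p} (P? : Dec P) {g} → (P → Spanned g) → Spanned (λ v → 𝟙 P? * g v)
  Spanned-𝟙 (yes p) g-spanned = Spanned-resp (λ v _ _ → *-identityˡ _) (g-spanned p)
  Spanned-𝟙 (no _)  _         = Spanned-resp (λ v _ _ → zeroˡ _) Spanned-0#

  Spanned-upperSum : ∀ {A : Fin n → Fin n → (Fin n → Fin n) → Carrier} →
    (∀ {i j} → i <ᶠ j → Spanned (A i j)) → Spanned (λ v → upperSum (λ i j → A i j v))
  Spanned-upperSum A-spanned = Spanned-sum (λ i → Spanned-sum (λ j → Spanned-𝟙 (i <ᶠ? j) A-spanned))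

  -- Absorbing g into 𝔪(w) may add up to k two-cycles to w.
  MultiplesSpanned : ℕ → ((Fin n → Fin n) → Carrier) → Set (c ⊔ ℓ)
  MultiplesSpanned k g = ∀ {w} → IsInvolution w → twoCycles w ℕ.+ k ≤ d → Spanned (λ v → eval𝔪 w v * g v)

  MultiplesSpanned-resp : ∀ {k g h} → (∀ v → IsInvolution v → twoCycles v ≡ m → g v ≈ h v) →
    MultiplesSpanned k h → MultiplesSpanned k g
  MultiplesSpanned-resp g≈h h-spanned w² budget =
    Spanned-resp (λ v v² tv → *-congˡ (g≈h v v² tv)) (h-spanned w² budget)

  MultiplesSpanned-upper : ∀ {k g i j} → i <ᶠ j → MultiplesSpanned k g →
    MultiplesSpanned (suc k) (λ v → permMatrix K v i j * g v)
  MultiplesSpanned-upper {k} {g} {i} {j} i<j g-spanned {w} w² budget =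
    Spanned-resp expand
      (Spanned-+ (Spanned-scale (permMatrix K w i j) (g-spanned w² (m+1+n≤o⇒m+n≤o (twoCycles w) budget)))
                 (Spanned-𝟙 (w i ≟ i) λ wi≡i → Spanned-𝟙 (w j ≟ j) λ wj≡j →
                    g-spanned (∘transpose-involution w² wi≡i wj≡j)
                      (≡.subst (_≤ d) (≡.sym (twoCycles-∘transpose-+ w² wi≡i wj≡j i<j k)) budget)))
    where
    expand : ∀ v → IsInvolution v → twoCycles v ≡ m →
      eval𝔪 w v * (permMatrix K v i j * g v)
        ≈ permMatrix K w i j * (eval𝔪 w v * g v)
          + 𝟙 (w i ≟ i) * (𝟙 (w j ≟ j) * (eval𝔪 (w ∘ transpose i j) v * g v))
    expand v v² _ = begin
      e * (x * g v)                                 ≈⟨ *-assoc e x (g v) ⟨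
      (e * x) * g v                                 ≈⟨ *-congʳ (*-comm e x) ⟩
      (x * e) * g v                                 ≈⟨ *-congʳ (permMatrix*eval𝔪 {v = v} w² v² i<j) ⟩
      (permMatrix K w i j * e + a * (b * e′)) * g v ≈⟨ distribʳ (g v) _ _ ⟩
      (permMatrix K w i j * e) * g v + (a * (b * e′)) * g v
                                                    ≈⟨ +-cong (*-assoc _ e (g v))
                                                              (trans (*-assoc a _ (g v)) (*-congˡ (*-assoc b e′ (g v)))) ⟩
      permMatrix K w i j * (e * g v) + a * (b * (e′ * g v)) ∎
      where
      e e′ x a b : Carrier
      e  = eval𝔪 w v
      e′ = eval𝔪 (w ∘ transpose i j) v
      x  = permMatrix K v i j
      a  = 𝟙 (w i ≟ i)
      b  = 𝟙 (w j ≟ j)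

  MultiplesSpanned-offDiagonal : ∀ {k g i j} → i ≢ j → MultiplesSpanned k g →
    MultiplesSpanned (suc k) (λ v → permMatrix K v i j * g v)
  MultiplesSpanned-offDiagonal {i = i} {j} i≢j g-spanned with <-cmp i j
  ... | tri< i<j _ _ = MultiplesSpanned-upper i<j g-spanned
  ... | tri≈ _ i≡j _ = contradiction i≡j i≢j
  ... | tri> _ _ j<i = MultiplesSpanned-resp (λ v v² _ → *-congʳ (reflexive (permMatrix-sym {v = v} v² i j)))
                                             (MultiplesSpanned-upper j<i g-spanned)

  MultiplesSpanned-diagonal : ∀ {k g} i → MultiplesSpanned k g →
    MultiplesSpanned (suc k) (λ v → permMatrix K v i i * g v)
  MultiplesSpanned-diagonal {k} {g} i g-spanned {w} w² budget =
    Spanned-resp expand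
      (Spanned-+ (g-spanned w² (m+1+n≤o⇒m+n≤o (twoCycles w) budget))
                 (Spanned-neg (Spanned-sum λ j → Spanned-𝟙 (¬? (j ≟ i)) λ j≢i →
                    MultiplesSpanned-offDiagonal (j≢i ∘ ≡.sym) g-spanned w² budget)))
    where
    expand : ∀ v → IsInvolution v → twoCycles v ≡ m →
      eval𝔪 w v * (permMatrix K v i i * g v)
        ≈ eval𝔪 w v * g v - sum (λ j → 𝟙 (¬? (j ≟ i)) * (eval𝔪 w v * (permMatrix K v i j * g v)))
    expand v _ _ = x≈z//y _ _ _ (begin
      e * (x i * g v) + sum (λ j → o j * (e * (x j * g v))) ≈⟨ +-congˡ (sum-cong-≋ (λ j → rearrange (o j))) ⟩
      e * (x i * g v) + sum (λ j → e * ((o j * x j) * g v)) ≈⟨ +-congˡ (*-distribˡ-sum e (λ j → ox j * g v)) ⟨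
      e * (x i * g v) + e * sum (λ j → (o j * x j) * g v)   ≈⟨ +-congˡ (*-congˡ (*-distribʳ-sum (g v) ox)) ⟨
      e * (x i * g v) + e * (sum (λ j → o j * x j) * g v)   ≈⟨ distribˡ e _ _ ⟨
      e * (x i * g v + sum (λ j → o j * x j) * g v)         ≈⟨ *-congˡ (distribʳ (g v) _ _) ⟨
      e * ((x i + sum (λ j → o j * x j)) * g v)             ≈⟨ *-congˡ (*-congʳ (permMatrix-diagonal v i)) ⟩
      e * (1# * g v)                                        ≈⟨ *-congˡ (*-identityˡ (g v)) ⟩
      e * g v                                               ∎)
      where
      e : Carrier
      e = eval𝔪 w v
      x o ox : Fin n → Carrier
      x = permMatrix K v i
      o j = 𝟙 (¬? (j ≟ i))
      ox j = o j * x j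
      rearrange : ∀ {j} a → a * (e * (x j * g v)) ≈ e * ((a * x j) * g v)
      rearrange {j} a = begin
        a * (e * (x j * g v)) ≈⟨ *-assoc a e _ ⟨
        (a * e) * (x j * g v) ≈⟨ *-congʳ (*-comm a e) ⟩
        (e * a) * (x j * g v) ≈⟨ *-assoc e a _ ⟩
        e * (a * (x j * g v)) ≈⟨ *-congˡ (*-assoc a (x j) (g v)) ⟨
        e * ((a * x j) * g v) ∎

  MultiplesSpanned-variable : ∀ {k g} i j → MultiplesSpanned k g →
    MultiplesSpanned (suc k) (λ v → permMatrix K v i j * g v)
  MultiplesSpanned-variable i j with i ≟ j
  ... | yes refl = MultiplesSpanned-diagonal i
  ... | no i≢j  = MultiplesSpanned-offDiagonal i≢j

  MultiplesSpanned-pow : ∀ {k g} i j e → MultiplesSpanned k g →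
    MultiplesSpanned (e ℕ.+ k) (λ v → pow K (permMatrix K v i j) e * g v)
  MultiplesSpanned-pow i j zero    g-spanned = MultiplesSpanned-resp (λ v _ _ → *-identityˡ _) g-spanned
  MultiplesSpanned-pow i j (suc e) g-spanned = MultiplesSpanned-resp (λ v _ _ → *-assoc _ _ _)
    (MultiplesSpanned-variable i j (MultiplesSpanned-pow i j e g-spanned))

  MultiplesSpanned-foldr : ∀ {a} {A : Set a} (deg : A → ℕ) (F : A → (Fin n → Fin n) → Carrier) →
    (∀ x {k g} → MultiplesSpanned k g → MultiplesSpanned (deg x ℕ.+ k) (λ v → F x v * g v)) →
    ∀ xs {k g} → MultiplesSpanned k g →
    MultiplesSpanned (foldr (λ x s → deg x ℕ.+ s) 0 xs ℕ.+ k) (λ v → foldr (λ x p → F x v * p) 1# xs * g v)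
  MultiplesSpanned-foldr deg F F-step []       g-spanned = MultiplesSpanned-resp (λ v _ _ → *-identityˡ _) g-spanned
  MultiplesSpanned-foldr deg F F-step (x ∷ xs) {k} g-spanned {w} w² budget =
    MultiplesSpanned-resp (λ v _ _ → *-assoc _ _ _) (F-step x (MultiplesSpanned-foldr deg F F-step xs g-spanned))
      w² (ℕP.≤-trans (ℕP.≤-reflexive (cong (twoCycles w ℕ.+_) (≡.sym (ℕP.+-assoc (deg x) degs k)))) budget)
    where
    degs : ℕ
    degs = foldr (λ x s → deg x ℕ.+ s) 0 xs

  MultiplesSpanned-evalMono : ∀ {k g} (α : Monomial n) → MultiplesSpanned k g →
    MultiplesSpanned (mdeg α ℕ.+ k) (λ v → evalMono K α (permMatrix K v) * g v)
  MultiplesSpanned-evalMono α =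
    MultiplesSpanned-foldr (λ i → sumFin (α i)) (λ i v → prodFin K (powers α (permMatrix K v) i))
      (λ i → MultiplesSpanned-foldr (α i) (λ j v → powers α (permMatrix K v) i j)
               (λ j → MultiplesSpanned-pow i j (α i j)) (allFin n))
      (allFin n)

  module _ (d≤m : d ≤ m) where

    eval𝔪-spanned : ∀ {w} → IsInvolution w → twoCycles w ≤ d → Spanned (eval𝔪 w)
    eval𝔪-spanned w² tw≤d = raise _ w² (ℕP.m+[n∸m]≡n tw≤d)
      where
      raise : ∀ k {w} → IsInvolution w → twoCycles w ℕ.+ k ≡ d → Spanned (eval𝔪 w)
      raise zero    w² tw+0≡d = Spanned-eval𝔪 w² (≡.trans (≡.sym (ℕP.+-identityʳ _)) tw+0≡d)
      raise (suc k) {w} w² tw+1+k≡d = Spanned-resp rescale (Spanned-scale y (Spanned-upperSum adjoined-spanned))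
        where
        tw<m : twoCycles w ℕ.< m
        tw<m = ℕP.m+n≤o⇒m≤o (suc (twoCycles w))
                 (≡.subst (_≤ m) (≡.trans (≡.sym tw+1+k≡d) (ℕP.+-suc (twoCycles w) k)) d≤m)
        r : ℕ
        r = proj₁ (ℕP.m≤n⇒∃[o]m+o≡n tw<m)
        m≡1+r+tw : m ≡ suc r ℕ.+ twoCycles w
        m≡1+r+tw = ≡.trans (≡.sym (proj₂ (ℕP.m≤n⇒∃[o]m+o≡n tw<m))) (cong suc (ℕP.+-comm (twoCycles w) r))
        y : Carrier
        y = proj₁ (inverse (ι (suc r)) (charZero r))
        adjoined-spanned : ∀ {i j} → i <ᶠ j → Spanned (adjoined𝔪 w i j)
        adjoined-spanned {i} {j} i<j = Spanned-𝟙 (w i ≟ i) λ wi≡i → Spanned-𝟙 (w j ≟ j) λ wj≡j →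
          raise k (∘transpose-involution w² wi≡i wj≡j)
            (≡.trans (twoCycles-∘transpose-+ w² wi≡i wj≡j i<j k) tw+1+k≡d)
        rescale : ∀ v → IsInvolution v → twoCycles v ≡ m →
          eval𝔪 w v ≈ y * upperSum (λ i j → adjoined𝔪 w i j v)
        rescale v v² tv≡m = x*a≈b⇒a≈y*b (proj₂ (inverse (ι (suc r)) (charZero r)))
                                         (natCast*eval𝔪 w² v² r (≡.trans tv≡m m≡1+r+tw))

    MultiplesSpanned-1# : MultiplesSpanned 0 (λ _ → 1#)
    MultiplesSpanned-1# w² budget =
      Spanned-resp (λ v _ _ → *-identityʳ _) (eval𝔪-spanned w² (≡.subst (_≤ d) (ℕP.+-identityʳ _) budget))

    evalMono-spanned : (α : Monomial n) → mdeg α ≤ d → Spanned (λ v → evalMono K α (permMatrix K v))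
    evalMono-spanned α α≤d =
      Spanned-resp expand (MultiplesSpanned-evalMono α MultiplesSpanned-1# {id} (λ _ → refl) budget)
      where
      budget : twoCycles {n} id ℕ.+ (mdeg α ℕ.+ 0) ≤ d
      budget = ≡.subst (_≤ d) (≡.sym (cong₂ ℕ._+_ (twoCycles-id {n}) (ℕP.+-identityʳ (mdeg α)))) α≤d
      expand : ∀ v → IsInvolution v → twoCycles v ≡ m →
        evalMono K α (permMatrix K v) ≈ eval𝔪 id v * (evalMono K α (permMatrix K v) * 1#)
      expand v _ _ = sym (trans (*-congʳ (evalMono-constant (𝔪 id) (permMatrix K v) (λ k l → 𝔪-nonedge <⇒≢)))
                                (trans (*-identityˡ _) (*-identityʳ _)))

    eval-spanned : (f : Poly K n) → DegLe K f d → Spanned (λ v → eval K f (permMatrix K v))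
    eval-spanned []            []          = Spanned-0#
    eval-spanned ((a , α) ∷ f) (α≤d ∷ f≤d) =
      Spanned-+ (Spanned-scale a (evalMono-spanned α α≤d)) (eval-spanned f f≤d)

lemma5p10 : ∀ {c ℓ} (K : CharZeroField c ℓ) (n a d : ℕ) →
    a ≤ n → 2 ∣ (n ∸ a) → d ≤ (n ∸ a) / 2 →
    (f : Poly K n) → DegLe K f d →
    Σ (List (CharZeroField.Carrier K × (Fin n → Fin n))) λ comb →
      All (λ t → IsInvolution (proj₂ t) × twoCycles (proj₂ t) ≡ d) comb ×
      ((v : Fin n → Fin n) → IsInvolution v → fixedPoints v ≡ a →
        CharZeroField._≈_ K (eval K f (permMatrix K v))
          (sumK K (λ t → CharZeroField._*_ K (proj₁ t) (evalMono K (𝔪 (proj₂ t)) (permMatrix K v))) comb))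
lemma5p10 K n a d _ (divides q n∸a≡q*2) d≤[n∸a]/2 f f≤d =
  proj₁ spanned , proj₁ (proj₂ spanned) , λ v v² fp≡a → proj₂ (proj₂ spanned) v v² (twoCycles≡q v² fp≡a)
  where
  d≤q : d ≤ q
  d≤q = ≡.subst (d ≤_) (≡.trans (cong (_/ 2) n∸a≡q*2) (m*n/n≡m q 2)) d≤[n∸a]/2
  spanned : Spanning.Spanned K n q d (λ v → eval K f (permMatrix K v))
  spanned = Spanning.eval-spanned K n q d d≤q f f≤d
  twoCycles≡q : ∀ {v : Fin n → Fin n} → IsInvolution v → fixedPoints v ≡ a → twoCycles v ≡ q
  twoCycles≡q v² fp≡a = n∸fixedPoints≡q*2⇒twoCycles≡q v² (≡.trans (cong (n ∸_) fp≡a) n∸a≡q*2)
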